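{- Let $p$ be a prime, $r\geq 2$ an integer, and $n\in\mathbb{N}$. Write $Z_p(n)=\alpha r+\beta$ with integers $\alpha\geq0$ and $0\leq\beta<r$. Then for an integer $k\geq 0$, $Z_{p^r}(n+1)-Z_{p^r}(n)=k$ if and only if $n+1=p^ma$ with $\gcd(p,a)=1$ and $kr\leq m+\beta<(k+1)r$.
   Context: For an integer $b\geq 2$, $Z_b(m)$ denotes the number of trailing zeroes in the base $b$ expansion of $m!$. Thus $Z_p(m)$ is the exponent of $p$ in $m!$, and $Z_{p^r}(m)=\lfloor Z_p(m)/r\rfloor$. -}

module Defs where

open import Data.Nat using (ℕ; zero; suc; _+_; _*_; _^_; _≤_; _<_; _!)
open import Data.Nat.Divisibility using (_∣?_)
open import Data.Nat.DivMod using (_/_)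
open import Relation.Nullary using (yes; no)

-- For base 1 (c = 0) it is not meaningful; we only use b ≥ 2.
trailingZerosAux : ℕ → ℕ → ℕ → ℕ
trailingZerosAux zero    c x = zero
trailingZerosAux (suc f) c zero = zero
trailingZerosAux (suc f) c (suc x) with suc c ∣? suc x
... | yes _ = suc (trailingZerosAux f c (suc x / suc c))
... | no  _ = zero

-- trailing zeroes of x in base b (b ≥ 2 intended; fuel x suffices)
trailingZeros : (b x : ℕ) → ℕ
trailingZeros zero    x = zero
trailingZeros (suc c) x = trailingZerosAux x c x

Z : (b m : ℕ) → ℕ
Z b m = trailingZeros b (m !)

{-# OPTIONS --safe #-}
module Submission where

-- Z_p(m) is the exponent of p in m!, and since p^r divides p^e w (with p ∤ w) exactly
-- ⌊e/r⌋ times, Z_{p^r}(m) = ⌊Z_p(m)/r⌋.  If n + 1 = p^m a with p ∤ a, then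
-- (n+1)! = p^m a · n! gives Z_p(n+1) = m + Z_p(n) = m + αr + β, hence
-- Z_{p^r}(n+1) = α + ⌊(m+β)/r⌋ while Z_{p^r}(n) = α: the jump is k exactly when
-- kr ≤ m + β < (k+1)r.

open import Defs
open import Data.Nat using (ℕ; zero; suc; _+_; _*_; _^_; _≤_; _<_; _!; s≤s; z<s; NonZero; >-nonZero; >-nonZero⁻¹; nonTrivial⇒n>1)
open import Data.Nat.Properties
open import Data.Nat.Divisibility using (_∣_; _∣?_; divides; ∣-refl; _∣0; ∣-trans; m∣m*n; n∣m*n; *-cancelˡ-∣)
open import Data.Nat.DivMod using (_/_; _%_; m≡m%n+[m/n]*n; m%n<n; m*n/n≡m; m/n*n≤m; m<n*o⇒m/o<n; /-monoˡ-≤; m<n⇒m/n≡0; +-distrib-/-∣ˡ)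
open import Data.Nat.GCD using (gcd)
open import Data.Nat.Coprimality using (Coprime; coprime⇒gcd≡1; gcd≡1⇒coprime)
open import Data.Nat.Primality using (Prime; euclidsLemma; prime⇒irreducible; prime⇒nonTrivial)
open import Data.Nat.Induction using (<-rec)
open import Algebra.Properties.CommutativeSemigroup +-commutativeSemigroup using (x∙yz≈y∙xz)
open import Data.Product using (_×_; ∃-syntax; _,_)
open import Data.Sum using (inj₁; inj₂)
open import Data.Empty using (⊥-elim)
open import Function.Bundles using (_⇔_; mk⇔; Equivalence)
open import Relation.Binary.PropositionalEquality using (_≡_; refl; sym; trans; cong; cong₂; subst; module ≡-Reasoning)
open import Relation.Nullary using (¬_; yes; no)

n<m^n : ∀ {m} → 1 < m → ∀ n → n < m ^ n
n<m^n {m} 1<m zero    = m^n>0 m {{>-nonZero (<-trans z<s 1<m)}} 0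
n<m^n {m} 1<m (suc n) = ≤-<-trans (n<m^n 1<m n) (^-monoʳ-< m 1<m (n<1+n n))

m/n≡o⇔o*n≤m<[1+o]*n : ∀ m n o .{{_ : NonZero n}} → (m / n ≡ o) ⇔ (o * n ≤ m × m < suc o * n)
m/n≡o⇔o*n≤m<[1+o]*n m n o = mk⇔ bounds quotient
  where
  bounds : m / n ≡ o → o * n ≤ m × m < suc o * n
  bounds refl = m/n*n≤m m n , (begin-strict
    m                  ≡⟨ m≡m%n+[m/n]*n m n ⟩
    m % n + m / n * n  <⟨ +-monoˡ-< (m / n * n) (m%n<n m n) ⟩
    n + m / n * n      ∎)
    where open ≤-Reasoning
  quotient : o * n ≤ m × m < suc o * n → m / n ≡ o
  quotient (lo , hi) =
    ≤-antisym (≤-pred (m<n*o⇒m/o<n hi)) (subst (_≤ m / n) (m*n/n≡m o n) (/-monoˡ-≤ n lo))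

[m*n+o]/n≡m+o/n : ∀ m n o .{{_ : NonZero n}} → (m * n + o) / n ≡ m + o / n
[m*n+o]/n≡m+o/n m n o = trans (+-distrib-/-∣ˡ o (n∣m*n m)) (cong (_+ o / n) (m*n/n≡m m n))

trailingZerosAux-unique : ∀ f c {e y} x → x ≡ suc c ^ e * y → ¬ suc c ∣ y → e < f →
                          trailingZerosAux f c x ≡ e
trailingZerosAux-unique (suc f) c {e} {y} zero eq c+1∤y _
  with m*n≡0⇒m≡0∨n≡0 (suc c ^ e) (sym eq)
... | inj₁ bᵉ≡0 = ⊥-elim (1+n≢0 (m^n≡0⇒m≡0 (suc c) e bᵉ≡0))
... | inj₂ refl = ⊥-elim (c+1∤y (suc c ∣0))
trailingZerosAux-unique (suc f) c {e} {y} (suc x) eq c+1∤y e<f with suc c ∣? suc x | e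
... | yes c+1∣x | zero  = ⊥-elim (c+1∤y (subst (suc c ∣_) (trans eq (*-identityˡ y)) c+1∣x))
... | no _      | zero  = refl
... | yes _     | suc e = cong suc (trailingZerosAux-unique f c (suc x / suc c) x/b≡ c+1∤y (≤-pred e<f))
  where
  x/b≡ : suc x / suc c ≡ suc c ^ e * y
  x/b≡ = begin
    suc x / suc c                 ≡⟨ cong (_/ suc c) eq ⟩
    suc c * suc c ^ e * y / suc c  ≡⟨ cong (_/ suc c) (trans (*-assoc (suc c) (suc c ^ e) y) (*-comm (suc c) (suc c ^ e * y))) ⟩
    suc c ^ e * y * suc c / suc c  ≡⟨ m*n/n≡m (suc c ^ e * y) (suc c) ⟩
    suc c ^ e * y                 ∎
    where open ≡-Reasoning
... | no c+1∤x  | suc e =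
  ⊥-elim (c+1∤x (subst (suc c ∣_) (sym (trans eq (*-assoc (suc c) (suc c ^ e) y))) (m∣m*n _)))

trailingZeros-unique : ∀ {b e y} x → 1 < b → x ≡ b ^ e * y → ¬ b ∣ y → trailingZeros b x ≡ e
trailingZeros-unique {b} {e} {zero}  x 1<b eq b∤y = ⊥-elim (b∤y (b ∣0))
trailingZeros-unique {suc c} {e} {suc y} x 1<b eq b∤y =
  trailingZerosAux-unique x c x eq b∤y
    (subst (e <_) (sym eq) (<-≤-trans (n<m^n 1<b e) (m≤m*n (suc c ^ e) (suc y))))

factor-out : ∀ {b} → 1 < b → ∀ x → 0 < x → ∃[ e ] ∃[ y ] (x ≡ b ^ e * y × ¬ b ∣ y)
factor-out {b} 1<b = <-rec _ factor
  where
  instance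
    b≢0 : NonZero b
    b≢0 = >-nonZero (<-trans z<s 1<b)
  factor : ∀ x → (∀ {z} → z < x → 0 < z → ∃[ e ] ∃[ y ] (z ≡ b ^ e * y × ¬ b ∣ y)) →
           0 < x → ∃[ e ] ∃[ y ] (x ≡ b ^ e * y × ¬ b ∣ y)
  factor x rec 0<x with b ∣? x
  ... | no b∤x = 0 , x , sym (*-identityˡ x) , b∤x
  ... | yes (divides zero x≡0) = ⊥-elim (n≮0 (subst (0 <_) x≡0 0<x))
  ... | yes (divides q@(suc _) x≡q*b) with rec (subst (q <_) (sym x≡q*b) (m<m*n q b 1<b)) z<s
  ...   | e , y , q≡bᵉ*y , b∤y = suc e , y , x≡ , b∤y
    where
    x≡ : x ≡ b ^ suc e * y
    x≡ = begin
      x             ≡⟨ x≡q*b ⟩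
      q * b         ≡⟨ *-comm q b ⟩
      b * q         ≡⟨ cong (b *_) q≡bᵉ*y ⟩
      b * (b ^ e * y) ≡⟨ *-assoc b (b ^ e) y ⟨
      b ^ suc e * y ∎
      where open ≡-Reasoning

factorisation : ∀ {b} → 1 < b → ∀ x → 0 < x → ∃[ y ] (x ≡ b ^ trailingZeros b x * y × ¬ b ∣ y)
factorisation {b} 1<b x 0<x with factor-out 1<b x 0<x
... | e , y , x≡ , b∤y =
  y , subst (λ t → x ≡ b ^ t * y) (sym (trailingZeros-unique {e = e} x 1<b x≡ b∤y)) x≡ , b∤y

p^r∤p^s*w : ∀ {p r s w} .{{_ : NonZero p}} → s < r → ¬ p ∣ w → ¬ p ^ r ∣ p ^ s * w
p^r∤p^s*w {p} {suc r} {zero}  {w} _         p∤w pʳ∣w =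
  p∤w (∣-trans (m∣m*n (p ^ r)) (subst (p ^ suc r ∣_) (*-identityˡ w) pʳ∣w))
p^r∤p^s*w {p} {suc r} {suc s} {w} (s≤s s<r) p∤w pʳ∣pˢw =
  p^r∤p^s*w s<r p∤w (*-cancelˡ-∣ p (subst (p ^ suc r ∣_) (*-assoc p (p ^ s) w) pʳ∣pˢw))

trailingZeros-pow : ∀ {p e w} x r .{{_ : NonZero r}} → 1 < p → x ≡ p ^ e * w → ¬ p ∣ w →
                    trailingZeros (p ^ r) x ≡ e / r
trailingZeros-pow {p} {e} {w} x r 1<p x≡ p∤w =
  trailingZeros-unique {e = e / r} x (^-monoʳ-< p 1<p (>-nonZero⁻¹ r)) x≡pʳ^q*y
    (p^r∤p^s*w {{p≢0}} (m%n<n e r) p∤w)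
  where
  p≢0 : NonZero p
  p≢0 = >-nonZero (<-trans z<s 1<p)
  x≡pʳ^q*y : x ≡ (p ^ r) ^ (e / r) * (p ^ (e % r) * w)
  x≡pʳ^q*y = begin
    x                                       ≡⟨ x≡ ⟩
    p ^ e * w                               ≡⟨ cong (λ t → p ^ t * w) (trans (m≡m%n+[m/n]*n e r) (+-comm (e % r) _)) ⟩
    p ^ (e / r * r + e % r) * w             ≡⟨ cong (_* w) (^-distribˡ-+-* p (e / r * r) (e % r)) ⟩
    p ^ (e / r * r) * p ^ (e % r) * w       ≡⟨ *-assoc (p ^ (e / r * r)) (p ^ (e % r)) w ⟩
    p ^ (e / r * r) * (p ^ (e % r) * w)     ≡⟨ cong (λ t → p ^ t * (p ^ (e % r) * w)) (*-comm (e / r) r) ⟩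
    p ^ (r * (e / r)) * (p ^ (e % r) * w)   ≡⟨ cong (_* (p ^ (e % r) * w)) (^-*-assoc p r (e / r)) ⟨
    (p ^ r) ^ (e / r) * (p ^ (e % r) * w)   ∎
    where open ≡-Reasoning

prime⇒1<p : ∀ {p} → Prime p → 1 < p
prime⇒1<p {p} p-prime = nonTrivial⇒n>1 p {{prime⇒nonTrivial p-prime}}

prime∤* : ∀ {p m n} → Prime p → ¬ p ∣ m → ¬ p ∣ n → ¬ p ∣ m * n
prime∤* {m = m} {n} p-prime p∤m p∤n p∣mn with euclidsLemma m n p-prime p∣mn
... | inj₁ p∣m = p∤m p∣m
... | inj₂ p∣n = p∤n p∣n

gcd≡1⇒prime∤ : ∀ {p a} → Prime p → gcd p a ≡ 1 → ¬ p ∣ a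
gcd≡1⇒prime∤ p-prime gcd≡1 p∣a =
  <-irrefl (sym (gcd≡1⇒coprime gcd≡1 (∣-refl , p∣a))) (prime⇒1<p p-prime)

prime∤⇒gcd≡1 : ∀ {p a} → Prime p → ¬ p ∣ a → gcd p a ≡ 1
prime∤⇒gcd≡1 {p} {a} p-prime p∤a = coprime⇒gcd≡1 coprime
  where
  coprime : Coprime p a
  coprime (d∣p , d∣a) with prime⇒irreducible p-prime d∣p
  ... | inj₁ d≡1 = d≡1
  ... | inj₂ refl = ⊥-elim (p∤a d∣a)

Z-pow : ∀ {p} → 1 < p → ∀ r .{{_ : NonZero r}} n → Z (p ^ r) n ≡ Z p n / r
Z-pow 1<p r n with factorisation 1<p (n !) (1≤n! n)
... | u , n!≡ , p∤u = trailingZeros-pow (n !) r 1<p n!≡ p∤u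

Z-suc : ∀ {p n m a} → Prime p → suc n ≡ p ^ m * a → ¬ p ∣ a → Z p (suc n) ≡ m + Z p n
Z-suc {p} {n} {m} {a} p-prime 1+n≡ p∤a with factorisation (prime⇒1<p p-prime) (n !) (1≤n! n)
... | u , n!≡ , p∤u = trailingZeros-unique (suc n !) (prime⇒1<p p-prime) [1+n]!≡ (prime∤* p-prime p∤a p∤u)
  where
  v : ℕ
  v = Z p n
  [1+n]!≡ : suc n ! ≡ p ^ (m + v) * (a * u)
  [1+n]!≡ = begin
    suc n * n !               ≡⟨ cong₂ _*_ 1+n≡ n!≡ ⟩
    p ^ m * a * (p ^ v * u)   ≡⟨ [m*n]*[o*p]≡[m*o]*[n*p] (p ^ m) a (p ^ v) u ⟩
    p ^ m * p ^ v * (a * u)   ≡⟨ cong (_* (a * u)) (^-distribˡ-+-* p m v) ⟨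
    p ^ (m + v) * (a * u)     ∎
    where open ≡-Reasoning

Z[p^r][1+n]≡Z[p^r][n]+[m+β]/r : ∀ {p r n α β m a} → Prime p → .{{_ : NonZero r}} →
  Z p n ≡ α * r + β → β < r → suc n ≡ p ^ m * a → ¬ p ∣ a →
  Z (p ^ r) (suc n) ≡ Z (p ^ r) n + (m + β) / r
Z[p^r][1+n]≡Z[p^r][n]+[m+β]/r {p} {r} {n} {α} {β} {m} p-prime Zₚn≡ β<r 1+n≡ p∤a = begin
  Z (p ^ r) (suc n)          ≡⟨ Z-pow 1<p r (suc n) ⟩
  Z p (suc n) / r            ≡⟨ cong (_/ r) (Z-suc p-prime 1+n≡ p∤a) ⟩
  (m + Z p n) / r            ≡⟨ cong (λ t → (m + t) / r) Zₚn≡ ⟩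
  (m + (α * r + β)) / r      ≡⟨ cong (_/ r) (x∙yz≈y∙xz m (α * r) β) ⟩
  (α * r + (m + β)) / r      ≡⟨ [m*n+o]/n≡m+o/n α r (m + β) ⟩
  α + (m + β) / r            ≡⟨ cong (_+ (m + β) / r) Z[p^r][n]≡α ⟨
  Z (p ^ r) n + (m + β) / r  ∎
  where
  open ≡-Reasoning
  1<p : 1 < p
  1<p = prime⇒1<p p-prime
  Z[p^r][n]≡α : Z (p ^ r) n ≡ α
  Z[p^r][n]≡α = begin
    Z (p ^ r) n        ≡⟨ Z-pow 1<p r n ⟩
    Z p n / r          ≡⟨ cong (_/ r) Zₚn≡ ⟩
    (α * r + β) / r    ≡⟨ [m*n+o]/n≡m+o/n α r β ⟩
    α + β / r          ≡⟨ cong (α +_) (m<n⇒m/n≡0 β<r) ⟩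
    α + 0              ≡⟨ +-identityʳ α ⟩
    α                  ∎

proposition6 : (p r n α β k : ℕ) → Prime p → 2 ≤ r →
    Z p n ≡ α * r + β → β < r →
    (Z (p ^ r) (suc n) ≡ Z (p ^ r) n + k) ⇔
      (∃[ m ] ∃[ a ] (suc n ≡ p ^ m * a × gcd p a ≡ 1 × k * r ≤ m + β × m + β < suc k * r))
proposition6 p r n α β k p-prime 2≤r Zₚn≡ β<r = mk⇔ factorise unfactorise
  where
  instance
    r≢0 : NonZero r
    r≢0 = >-nonZero (<-trans z<s 2≤r)
  step : ∀ {m a} → suc n ≡ p ^ m * a → ¬ p ∣ a → Z (p ^ r) (suc n) ≡ Z (p ^ r) n + (m + β) / r
  step = Z[p^r][1+n]≡Z[p^r][n]+[m+β]/r {α = α} p-prime Zₚn≡ β<r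
  factorise : Z (p ^ r) (suc n) ≡ Z (p ^ r) n + k →
    ∃[ m ] ∃[ a ] (suc n ≡ p ^ m * a × gcd p a ≡ 1 × k * r ≤ m + β × m + β < suc k * r)
  factorise jump with factor-out (prime⇒1<p p-prime) (suc n) z<s
  ... | m , a , 1+n≡ , p∤a = m , a , 1+n≡ , prime∤⇒gcd≡1 p-prime p∤a ,
    Equivalence.to (m/n≡o⇔o*n≤m<[1+o]*n (m + β) r k)
      (+-cancelˡ-≡ (Z (p ^ r) n) _ k (trans (sym (step 1+n≡ p∤a)) jump))
  unfactorise : ∃[ m ] ∃[ a ] (suc n ≡ p ^ m * a × gcd p a ≡ 1 × k * r ≤ m + β × m + β < suc k * r) →
    Z (p ^ r) (suc n) ≡ Z (p ^ r) n + k
  unfactorise (m , a , 1+n≡ , gcd≡1 , bounds) =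
    trans (step 1+n≡ (gcd≡1⇒prime∤ p-prime gcd≡1))
      (cong (Z (p ^ r) n +_) (Equivalence.from (m/n≡o⇔o*n≤m<[1+o]*n (m + β) r k) bounds))
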